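{- Let $C(n,p)$ be a cycle permutation graph. Then $\chi'_{N}(C(n,p))\leq 6$.
   Context: A cycle permutation graph is a cubic graph of order $2n$ that admits a $2$-factor consisting of two disjoint chordless $n$-cycles. For a permutation $p$ of $\{0,\dots,n-1\}$, $C(n,p)$ denotes the graph with vertices $u_0,\dots,u_{n-1}$ forming a cycle (edges $u_iu_{i+1}$), $v_0,\dots,v_{n-1}$ forming a cycle (edges $v_iv_{i+1}$), indices modulo $n$, and the edges $v_iu_{p(i)}$. A $k$-edge-coloring is a proper edge-coloring with colors from $\{1,\dots,k\}$. For an edge-coloring $c$ and a vertex $v$, let $S_c(v)$ be the set of colors on edges incident with $v$. An edge $uv$ of a cubic graph is poor if $|S_c(u)\cup S_c(v)|=3$, rich if $|S_c(u)\cup S_c(v)|=5$, and normal if it is poor or rich. An edge-coloring is normal if every edge is normal. $\chi'_N(G)$ is the smallest $k$ such that $G$ admits a normal $k$-edge-coloring. -}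

module Defs where

open import Data.Nat using (ℕ; zero; suc)
open import Data.Nat.DivMod using (_mod_)
open import Data.Fin using (Fin; toℕ)
open import Data.Fin.Properties using (_≟_)
open import Data.Fin.Subset using (Subset; ⁅_⁆; _∪_; ⊥; ∣_∣)
open import Data.Fin.Permutation using (Permutation′; _⟨$⟩ʳ_)
open import Data.List using (List; map; filter; foldr; _++_; allFin)
open import Data.Sum using (_⊎_; inj₁; inj₂)
open import Data.Sum.Properties using (≡-dec)
open import Data.Product using (_×_; _,_; proj₁; proj₂; ∃)
open import Relation.Binary.PropositionalEquality using (_≡_; _≢_)
open import Relation.Nullary using (Dec; _⊎-dec_)
open import Relation.Binary.Definitions using (DecidableEquality)

next : {n : ℕ} → Fin n → Fin n
next {suc m} i = suc (toℕ i) mod suc m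

Vtx : ℕ → Set
Vtx n = Fin n ⊎ Fin n

u : {n : ℕ} → Fin n → Vtx n
u = inj₁

v : {n : ℕ} → Fin n → Vtx n
v = inj₂

_≟V_ : {n : ℕ} → DecidableEquality (Vtx n)
_≟V_ = ≡-dec _≟_ _≟_

data Edge (n : ℕ) : Set where
  uu : Fin n → Edge n
  vv : Fin n → Edge n
  vu : Fin n → Edge n

ends : {n : ℕ} → Permutation′ n → Edge n → Vtx n × Vtx n
ends p (uu i) = u i , u (next i)
ends p (vv i) = v i , v (next i)
ends p (vu i) = v i , u (p ⟨$⟩ʳ i)

allEdges : (n : ℕ) → List (Edge n)
allEdges n = map uu (allFin n) ++ map vv (allFin n) ++ map vu (allFin n)

Incident : {n : ℕ} → Permutation′ n → Vtx n → Edge n → Set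
Incident p x e = x ≡ proj₁ (ends p e) ⊎ x ≡ proj₂ (ends p e)

incident? : {n : ℕ} (p : Permutation′ n) (x : Vtx n) (e : Edge n) → Dec (Incident p x e)
incident? p x e = (x ≟V proj₁ (ends p e)) ⊎-dec (x ≟V proj₂ (ends p e))

-- an edge-coloring with colors Fin k (representing {1,…,k})
Coloring : ℕ → ℕ → Set
Coloring n k = Edge n → Fin k

Proper : {n k : ℕ} → Permutation′ n → Coloring n k → Set
Proper {n} p c = (e e′ : Edge n) → e ≢ e′ →
  ∃ (λ x → Incident p x e × Incident p x e′) → c e ≢ c e′

S : {n k : ℕ} → Permutation′ n → Coloring n k → Vtx n → Subset k
S {n} p c x = foldr (λ e acc → ⁅ c e ⁆ ∪ acc) ⊥ (filter (incident? p x) (allEdges n))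

NormalEdge : {n k : ℕ} → Permutation′ n → Coloring n k → Edge n → Set
NormalEdge p c e =
  ∣ S p c (proj₁ (ends p e)) ∪ S p c (proj₂ (ends p e)) ∣ ≡ 3
  ⊎ ∣ S p c (proj₁ (ends p e)) ∪ S p c (proj₂ (ends p e)) ∣ ≡ 5

NormalColoring : {n k : ℕ} → Permutation′ n → Coloring n k → Set
NormalColoring {n} p c = Proper p c × ((e : Edge n) → NormalEdge p c e)

-- Colour the two n-cycles with the Klein group ℤ₂² (colours 0–3) and the spokes with two further
-- colours (4, 5). If the two cycle colours at a vertex differ by δ = (σ, d) ≠ 0, the spoke there
-- gets colour 4 + σ. A cycle edge is then poor when the δ's at its ends agree and rich when their
-- σ's differ, and a spoke is normal as soon as both its ends carry the same δ: they see two cosets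
-- of {0, δ} in ℤ₂², which are equal or disjoint. For even n both cycles alternate two colours
-- (δ ≡ (0, 1)). For odd n this is impossible, since the δ's sum to 0 around a cycle; instead each
-- cycle gets one vertex with δ = (1, 0) and one non-adjacent vertex with δ = (1, 1), matched along
-- spokes, which n ≥ 7 leaves room for. The graphs C(3, p) and C(5, p), among them the Petersen
-- graph, are handled by explicit colourings checked by evaluation.

module Submission where

open import Defs
open import Data.Nat as ℕ using (ℕ; zero; suc; _+_; _<_; _≤_; z≤n; s≤s; _%_)
import Data.Nat.Properties as ℕ
open import Data.Nat.DivMod using (m<n⇒m%n≡m; n%n≡0)
open import Data.Bool using (Bool; true; false; not; _∧_; _∨_; _xor_; T; if_then_else_)
open import Data.Bool.Properties
  using (T-∧; ∨-zeroʳ; ∨-identityʳ; xor-same; xor-assoc; xor-inverseˡ; xor-inverseʳ; xor-identityʳ; xor-∧-commutativeRing)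
open import Data.Bool.ListAction using (all)
open import Algebra.Bundles using (CommutativeRing)
open import Algebra.Properties.CommutativeSemigroup (CommutativeRing.+-commutativeSemigroup xor-∧-commutativeRing)
  using (interchange)
open import Data.Fin using (Fin; zero; suc; toℕ; fromℕ; inject₁; _≤?_)
open import Data.Fin.Patterns using (0F; 1F; 2F; 3F; 4F; 5F)
open import Data.Fin.Properties
  using (_≟_; all?; toℕ-injective; toℕ-fromℕ; toℕ-fromℕ<; toℕ-inject₁; toℕ<n; ≤fromℕ)
open import Data.Fin.Subset using (Subset; ⁅_⁆; _∪_; ⊥; _∈_; _⊆_; ∣_∣)
open import Data.Fin.Subset.Properties using (x∈p∪q⁻; x∈p∪q⁺; x∈⁅y⁆⇒x≡y; x∈⁅x⁆; ∉⊥; ⊆-antisym)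
open import Data.Fin.Permutation using (Permutation′; _⟨$⟩ʳ_; _⟨$⟩ˡ_; inverseˡ; inverseʳ)
open import Data.List using (List; []; _∷_; map; filter; foldr; allFin)
open import Data.List.Relation.Unary.Any using (here; there)
import Data.List.Relation.Unary.All as All
open import Data.List.Relation.Unary.All.Properties using (all⁺)
import Data.List.Membership.Propositional as List
open import Data.List.Membership.Propositional.Properties
  using (∈-filter⁺; ∈-filter⁻; ∈-map⁺; ∈-++⁺ˡ; ∈-++⁺ʳ; ∈-allFin)
open import Data.Vec using (Vec; []; _∷_; lookup; tabulate; replicate)
open import Data.Vec.Properties using (lookup∘tabulate)
open import Data.Sum using (_⊎_; inj₁; inj₂)
open import Data.Product using (_×_; _,_; proj₁; proj₂; Σ; ∃; ∃-syntax)
open import Function using (_∘_; _∘′_; mk⇔; Equivalence)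
open import Relation.Binary.Definitions using (DecidableEquality; tri<; tri≈; tri>)
open import Relation.Binary.PropositionalEquality
open import Relation.Nullary using (Dec; yes; no; does; ¬?; _×-dec_; _⊎-dec_; contradiction)
open import Relation.Nullary.Decidable using (isYes; toWitness; fromWitness; _→-dec_; dec-true; dec-false; does-⇔)

prev : {n : ℕ} → Fin n → Fin n
prev {suc m} zero    = fromℕ m
prev {suc m} (suc k) = inject₁ k

toℕ-next-< : ∀ {m} (i : Fin (suc m)) → toℕ i < m → toℕ (next i) ≡ suc (toℕ i)
toℕ-next-< {m} i i<m = trans (toℕ-fromℕ< _) (m<n⇒m%n≡m (s≤s i<m))

toℕ-next-last : ∀ {m} (i : Fin (suc m)) → toℕ i ≡ m → toℕ (next i) ≡ 0
toℕ-next-last {m} i i≡m = trans (toℕ-fromℕ< _) (trans (cong (λ k → suc k % suc m) i≡m) (n%n≡0 (suc m)))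

<-or-last : ∀ {m} (i : Fin (suc m)) → toℕ i < m ⊎ toℕ i ≡ m
<-or-last i = ℕ.m≤n⇒m<n∨m≡n (ℕ.≤-pred (toℕ<n i))

next-prev : ∀ {n} (j : Fin n) → next (prev j) ≡ j
next-prev {suc m} zero    = toℕ-injective (toℕ-next-last (fromℕ m) (toℕ-fromℕ m))
next-prev {suc m} (suc k) = toℕ-injective (begin
  toℕ (next (inject₁ k)) ≡⟨ toℕ-next-< (inject₁ k) (subst (_< m) (sym (toℕ-inject₁ k)) (toℕ<n k)) ⟩
  suc (toℕ (inject₁ k))  ≡⟨ cong suc (toℕ-inject₁ k) ⟩
  suc (toℕ k)            ∎)
  where open ≡-Reasoning

next-injective : ∀ {n} {i j : Fin n} → next i ≡ next j → i ≡ j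
next-injective {suc m} {i} {j} eq with <-or-last i | <-or-last j
... | inj₁ i<m | inj₁ j<m = toℕ-injective (ℕ.suc-injective
      (trans (sym (toℕ-next-< i i<m)) (trans (cong toℕ eq) (toℕ-next-< j j<m))))
... | inj₂ i≡m | inj₂ j≡m = toℕ-injective (trans i≡m (sym j≡m))
... | inj₁ i<m | inj₂ j≡m with () ← trans (sym (toℕ-next-< i i<m)) (trans (cong toℕ eq) (toℕ-next-last j j≡m))
... | inj₂ i≡m | inj₁ j<m with () ← trans (sym (toℕ-next-last i i≡m)) (trans (cong toℕ eq) (toℕ-next-< j j<m))

prev-next : ∀ {n} (i : Fin n) → prev (next i) ≡ i
prev-next i = next-injective (next-prev (next i))

next-zero : ∀ {m} → next {suc (suc m)} zero ≡ 1F
next-zero {m} = toℕ-injective (toℕ-next-< {suc m} zero (s≤s z≤n))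

Distinct₃ : {A : Set} → A → A → A → Set
Distinct₃ a b c = a ≢ b × a ≢ c × b ≢ c

ThreeOrFive : ℕ → Set
ThreeOrFive m = m ≡ 3 ⊎ m ≡ 5

ThreeOrFive? : ∀ m → Dec (ThreeOrFive m)
ThreeOrFive? m = m ℕ.≟ 3 ⊎-dec m ℕ.≟ 5

Distinct₃? : ∀ {k} (a b c : Fin k) → Dec (Distinct₃ a b c)
Distinct₃? a b c = ¬? (a ≟ b) ×-dec ¬? (a ≟ c) ×-dec ¬? (b ≟ c)

module _ {A : Set} {k : ℕ} (f : A → Fin k) where

  ∈-⋃⁅⁆⁻ : ∀ {x} xs → x ∈ foldr (λ a acc → ⁅ f a ⁆ ∪ acc) ⊥ xs → ∃ λ a → a List.∈ xs × x ≡ f a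
  ∈-⋃⁅⁆⁻ []       x∈ = contradiction x∈ ∉⊥
  ∈-⋃⁅⁆⁻ (a ∷ xs) x∈ with x∈p∪q⁻ ⁅ f a ⁆ _ x∈
  ... | inj₁ x∈⁅fa⁆ = a , here refl , x∈⁅y⁆⇒x≡y _ x∈⁅fa⁆
  ... | inj₂ x∈rest with ∈-⋃⁅⁆⁻ xs x∈rest
  ...   | b , b∈xs , x≡fb = b , there b∈xs , x≡fb

  ∈-⋃⁅⁆⁺ : ∀ {a} xs → a List.∈ xs → f a ∈ foldr (λ a acc → ⁅ f a ⁆ ∪ acc) ⊥ xs
  ∈-⋃⁅⁆⁺ (a ∷ xs) (here refl) = x∈p∪q⁺ (inj₁ (x∈⁅x⁆ (f a)))
  ∈-⋃⁅⁆⁺ (_ ∷ xs) (there a∈) = x∈p∪q⁺ (inj₂ (∈-⋃⁅⁆⁺ xs a∈))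

module Neighbourhood {n : ℕ} (p : Permutation′ n) where

  forwardEdge backwardEdge spokeEdge : Vtx n → Edge n
  forwardEdge (inj₁ j)  = uu j
  forwardEdge (inj₂ i)  = vv i
  backwardEdge (inj₁ j) = uu (prev j)
  backwardEdge (inj₂ i) = vv (prev i)
  spokeEdge (inj₁ j)    = vu (p ⟨$⟩ˡ j)
  spokeEdge (inj₂ i)    = vu i

  LocalEdge : Vtx n → Edge n → Set
  LocalEdge x e = e ≡ forwardEdge x ⊎ e ≡ backwardEdge x ⊎ e ≡ spokeEdge x

  incident⇒local : ∀ x e → Incident p x e → LocalEdge x e
  incident⇒local (inj₁ j) (uu i) (inj₁ refl) = inj₁ refl
  incident⇒local (inj₁ j) (uu i) (inj₂ refl) = inj₂ (inj₁ (cong uu (sym (prev-next i))))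
  incident⇒local (inj₂ j) (vv i) (inj₁ refl) = inj₁ refl
  incident⇒local (inj₂ j) (vv i) (inj₂ refl) = inj₂ (inj₁ (cong vv (sym (prev-next i))))
  incident⇒local (inj₂ j) (vu i) (inj₁ refl) = inj₂ (inj₂ refl)
  incident⇒local (inj₁ j) (vu i) (inj₂ refl) = inj₂ (inj₂ (cong vu (sym (inverseˡ p))))
  incident⇒local (inj₁ j) (vv i) (inj₁ ())
  incident⇒local (inj₁ j) (vv i) (inj₂ ())
  incident⇒local (inj₂ j) (uu i) (inj₁ ())
  incident⇒local (inj₂ j) (uu i) (inj₂ ())
  incident⇒local (inj₁ j) (vu i) (inj₁ ())
  incident⇒local (inj₂ j) (vu i) (inj₂ ())

  local⇒incident : ∀ x e → LocalEdge x e → Incident p x e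
  local⇒incident (inj₁ j) _ (inj₁ refl)        = inj₁ refl
  local⇒incident (inj₂ i) _ (inj₁ refl)        = inj₁ refl
  local⇒incident (inj₁ j) _ (inj₂ (inj₁ refl)) = inj₂ (cong inj₁ (sym (next-prev j)))
  local⇒incident (inj₂ i) _ (inj₂ (inj₁ refl)) = inj₂ (cong inj₂ (sym (next-prev i)))
  local⇒incident (inj₁ j) _ (inj₂ (inj₂ refl)) = inj₂ (cong inj₁ (sym (inverseʳ p)))
  local⇒incident (inj₂ i) _ (inj₂ (inj₂ refl)) = inj₁ refl

  ∈-allEdges : ∀ e → e List.∈ allEdges n
  ∈-allEdges (uu i) = ∈-++⁺ˡ (∈-map⁺ uu (∈-allFin i))
  ∈-allEdges (vv i) = ∈-++⁺ʳ (map uu (allFin n)) (∈-++⁺ˡ (∈-map⁺ vv (∈-allFin i)))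
  ∈-allEdges (vu i) = ∈-++⁺ʳ (map uu (allFin n)) (∈-++⁺ʳ (map vv (allFin n)) (∈-map⁺ vu (∈-allFin i)))

  module _ {k : ℕ} (c : Coloring n k) where

    localColours : Vtx n → Subset k
    localColours x = ⁅ c (forwardEdge x) ⁆ ∪ (⁅ c (backwardEdge x) ⁆ ∪ ⁅ c (spokeEdge x) ⁆)

    S⊆localColours : ∀ x → S p c x ⊆ localColours x
    S⊆localColours x col∈ with ∈-⋃⁅⁆⁻ c (filter (incident? p x) (allEdges n)) col∈
    ... | e , e∈ , refl with incident⇒local x e (proj₂ (∈-filter⁻ (incident? p x) {xs = allEdges n} e∈))
    ...   | inj₁ refl        = x∈p∪q⁺ (inj₁ (x∈⁅x⁆ _))
    ...   | inj₂ (inj₁ refl) = x∈p∪q⁺ (inj₂ (x∈p∪q⁺ (inj₁ (x∈⁅x⁆ _))))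
    ...   | inj₂ (inj₂ refl) = x∈p∪q⁺ (inj₂ (x∈p∪q⁺ (inj₂ (x∈⁅x⁆ _))))

    colour∈S : ∀ x e → LocalEdge x e → c e ∈ S p c x
    colour∈S x e x~e = ∈-⋃⁅⁆⁺ c (filter (incident? p x) (allEdges n))
      (∈-filter⁺ (incident? p x) (∈-allEdges e) (local⇒incident x e x~e))

    localColours⊆S : ∀ x → localColours x ⊆ S p c x
    localColours⊆S x col∈ with x∈p∪q⁻ _ _ col∈
    ... | inj₁ col∈₁ rewrite x∈⁅y⁆⇒x≡y _ col∈₁ = colour∈S x _ (inj₁ refl)
    ... | inj₂ col∈₂₃ with x∈p∪q⁻ _ _ col∈₂₃
    ...   | inj₁ col∈₂ rewrite x∈⁅y⁆⇒x≡y _ col∈₂ = colour∈S x _ (inj₂ (inj₁ refl))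
    ...   | inj₂ col∈₃ rewrite x∈⁅y⁆⇒x≡y _ col∈₃ = colour∈S x _ (inj₂ (inj₂ refl))

    S≡localColours : ∀ x → S p c x ≡ localColours x
    S≡localColours x = ⊆-antisym (S⊆localColours x) (localColours⊆S x)

    normalColoring-local :
      (∀ x → Distinct₃ (c (forwardEdge x)) (c (backwardEdge x)) (c (spokeEdge x))) →
      (∀ e → ThreeOrFive ∣ localColours (proj₁ (ends p e)) ∪ localColours (proj₂ (ends p e)) ∣) →
      NormalColoring p c
    normalColoring-local distinct threeOrFive = proper , normal
      where
      sameColour : ∀ {x e e′} → LocalEdge x e → LocalEdge x e′ → c e ≡ c e′ → e ≡ e′
      sameColour {x} (inj₁ refl)        (inj₁ refl)        _ = refl
      sameColour {x} (inj₂ (inj₁ refl)) (inj₂ (inj₁ refl)) _ = refl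
      sameColour {x} (inj₂ (inj₂ refl)) (inj₂ (inj₂ refl)) _ = refl
      sameColour {x} (inj₁ refl)        (inj₂ (inj₁ refl)) eq = contradiction eq (proj₁ (distinct x))
      sameColour {x} (inj₁ refl)        (inj₂ (inj₂ refl)) eq = contradiction eq (proj₁ (proj₂ (distinct x)))
      sameColour {x} (inj₂ (inj₁ refl)) (inj₂ (inj₂ refl)) eq = contradiction eq (proj₂ (proj₂ (distinct x)))
      sameColour {x} (inj₂ (inj₁ refl)) (inj₁ refl)        eq = contradiction (sym eq) (proj₁ (distinct x))
      sameColour {x} (inj₂ (inj₂ refl)) (inj₁ refl)        eq = contradiction (sym eq) (proj₁ (proj₂ (distinct x)))
      sameColour {x} (inj₂ (inj₂ refl)) (inj₂ (inj₁ refl)) eq = contradiction (sym eq) (proj₂ (proj₂ (distinct x)))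

      proper : Proper p c
      proper e e′ e≢e′ (x , x~e , x~e′) eq =
        e≢e′ (sameColour (incident⇒local x e x~e) (incident⇒local x e′ x~e′) eq)

      normal : ∀ e → NormalEdge p c e
      normal e rewrite S≡localColours (proj₁ (ends p e)) | S≡localColours (proj₂ (ends p e)) = threeOrFive e

-- Spoke colours W are indexed by the u-end of the spoke, so that deciding LocallyNormal for a
-- table π of the permutation needs no inverse of π.
module _ {N : ℕ} (π : Fin N → Fin N) (U V W : Fin N → Fin 6) where

  starᵘ starᵛ : Fin N → Subset 6
  starᵘ j = ⁅ U j ⁆ ∪ (⁅ U (prev j) ⁆ ∪ ⁅ W j ⁆)
  starᵛ i = ⁅ V i ⁆ ∪ (⁅ V (prev i) ⁆ ∪ ⁅ W (π i) ⁆)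

  LocallyNormal : Set
  LocallyNormal =
    (∀ j → Distinct₃ (U j) (U (prev j)) (W j) × ThreeOrFive ∣ starᵘ j ∪ starᵘ (next j) ∣) ×
    (∀ i → Distinct₃ (V i) (V (prev i)) (W (π i)) ×
           ThreeOrFive ∣ starᵛ i ∪ starᵛ (next i) ∣ × ThreeOrFive ∣ starᵛ i ∪ starᵘ (π i) ∣)

  locallyNormal? : Dec LocallyNormal
  locallyNormal? =
    all? (λ j → Distinct₃? _ _ _ ×-dec ThreeOrFive? _) ×-dec
    all? (λ i → Distinct₃? _ _ _ ×-dec ThreeOrFive? _ ×-dec ThreeOrFive? _)

LocallyNormal-resp : ∀ {N} {π π′ : Fin N → Fin N} {U V W} → (∀ i → π i ≡ π′ i) →
  LocallyNormal π U V W → LocallyNormal π′ U V W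
LocallyNormal-resp {π = π} {π′} {U} {V} {W} π≗π′ (onU , onV) = onU , onV′
  where
  onV′ : ∀ i → Distinct₃ (V i) (V (prev i)) (W (π′ i)) ×
               ThreeOrFive ∣ starᵛ π′ U V W i ∪ starᵛ π′ U V W (next i) ∣ ×
               ThreeOrFive ∣ starᵛ π′ U V W i ∪ starᵘ π′ U V W (π′ i) ∣
  onV′ i rewrite sym (π≗π′ i) | sym (π≗π′ (next i)) = onV i

module _ {N : ℕ} (p : Permutation′ N) (U V W : Fin N → Fin 6) where
  open Neighbourhood p

  explicitColouring : Coloring N 6
  explicitColouring (uu j) = U j
  explicitColouring (vv i) = V i
  explicitColouring (vu i) = W (p ⟨$⟩ʳ i)

  explicitColouring-normal : LocallyNormal (p ⟨$⟩ʳ_) U V W → NormalColoring p explicitColouring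
  explicitColouring-normal (onU , onV) = normalColoring-local explicitColouring distinct threeOrFive
    where
    spoke-u : ∀ j → explicitColouring (spokeEdge (u j)) ≡ W j
    spoke-u j = cong W (inverseʳ p)

    localColours-u : ∀ j → localColours explicitColouring (u j) ≡ starᵘ (p ⟨$⟩ʳ_) U V W j
    localColours-u j = cong (λ s → _ ∪ (_ ∪ ⁅ s ⁆)) (spoke-u j)

    distinct : ∀ x → Distinct₃ (explicitColouring (forwardEdge x)) (explicitColouring (backwardEdge x))
                               (explicitColouring (spokeEdge x))
    distinct (inj₁ j) rewrite spoke-u j = proj₁ (onU j)
    distinct (inj₂ i) = proj₁ (onV i)

    threeOrFive : ∀ e → ThreeOrFive ∣ localColours explicitColouring (proj₁ (ends p e)) ∪
                                      localColours explicitColouring (proj₂ (ends p e)) ∣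
    threeOrFive (uu j) rewrite localColours-u j | localColours-u (next j) = proj₂ (onU j)
    threeOrFive (vv i) = proj₁ (proj₂ (onV i))
    threeOrFive (vu i) rewrite localColours-u (p ⟨$⟩ʳ i) = proj₂ (proj₂ (onV i))

T-⇒ : ∀ a b → T (if a then b else true) → T a → T b
T-⇒ true b h _ = h

allVectors : {A : Set} → List A → ∀ k → (Vec A k → Bool) → Bool
allVectors xs zero    f = f []
allVectors xs (suc k) f = all (λ x → allVectors xs k (f ∘ (x ∷_))) xs

module _ {A : Set} {xs : List A} (complete : ∀ x → x List.∈ xs) where

  all-sound : ∀ (f : A → Bool) → T (all f xs) → ∀ x → T (f x)
  all-sound f h x = All.lookup (all⁺ f xs h) (complete x)

  allVectors-sound : ∀ k (f : Vec A k → Bool) → T (allVectors xs k f) → ∀ v → T (f v)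
  allVectors-sound zero    f h []      = h
  allVectors-sound (suc k) f h (x ∷ v) = allVectors-sound k (f ∘ (x ∷_)) (all-sound _ h x) v

  module _ {k : ℕ} (P : Vec A k → Set) (P? : ∀ v → Dec (P v)) (premise : Vec A k → Bool) where

    byExhaustion : T (allVectors xs k (λ v → if premise v then isYes (P? v) else true)) →
                   ∀ v → T (premise v) → P v
    byExhaustion h v pv = toWitness (T-⇒ _ _ (allVectors-sound k _ h v) pv)

allBools : List Bool
allBools = false ∷ true ∷ []

∈-allBools : ∀ b → b List.∈ allBools
∈-allBools false = here refl
∈-allBools true  = there (here refl)

T-not-xor : ∀ {x y} → x ≡ y → T (not (x xor y))
T-not-xor {false} refl = _
T-not-xor {true}  refl = _

T-∧-intro : ∀ {x y} → T x → T y → T (x ∧ y)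
T-∧-intro tx ty = Equivalence.from T-∧ (tx , ty)

cycleColour : Bool → Bool → Fin 6
cycleColour false false = 0F
cycleColour true  false = 1F
cycleColour false true  = 2F
cycleColour true  true  = 3F

spokeColour : Bool → Fin 6
spokeColour false = 4F
spokeColour true  = 5F

starColours : (b₀ t₀ b₁ t₁ : Bool) → Subset 6
starColours b₀ t₀ b₁ t₁ = ⁅ cycleColour b₁ t₁ ⁆ ∪ (⁅ cycleColour b₀ t₀ ⁆ ∪ ⁅ spokeColour (b₀ xor b₁) ⁆)

-- (σ, d) is the difference of the two cycle colours at a vertex; Compatible (σ, d) (σ′, d′) says
-- that a cycle edge between two such vertices is normal.
Nonzero : Bool → Bool → Bool
Nonzero σ d = d ∨ σ

Compatible : Bool → Bool → Bool → Bool → Bool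
Compatible σ d σ′ d′ = not (d xor d′) ∨ (σ xor σ′)

star-distinct : ∀ b₀ t₀ b₁ t₁ → T (Nonzero (b₀ xor b₁) (t₀ xor t₁)) →
  Distinct₃ (cycleColour b₁ t₁) (cycleColour b₀ t₀) (spokeColour (b₀ xor b₁))
star-distinct b₀ t₀ b₁ t₁ =
  byExhaustion ∈-allBools P (λ { (b₀ ∷ t₀ ∷ b₁ ∷ t₁ ∷ []) → Distinct₃? _ _ _ }) premise _
    (b₀ ∷ t₀ ∷ b₁ ∷ t₁ ∷ [])
  where
  P : Vec Bool 4 → Set
  P (b₀ ∷ t₀ ∷ b₁ ∷ t₁ ∷ []) = Distinct₃ (cycleColour b₁ t₁) (cycleColour b₀ t₀) (spokeColour (b₀ xor b₁))
  premise : Vec Bool 4 → Bool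
  premise (b₀ ∷ t₀ ∷ b₁ ∷ t₁ ∷ []) = Nonzero (b₀ xor b₁) (t₀ xor t₁)

cycleEdge-threeOrFive : ∀ b₀ t₀ b₁ t₁ b₂ t₂ →
  T (Nonzero (b₀ xor b₁) (t₀ xor t₁)) → T (Nonzero (b₁ xor b₂) (t₁ xor t₂)) →
  T (Compatible (b₀ xor b₁) (t₀ xor t₁) (b₁ xor b₂) (t₁ xor t₂)) →
  ThreeOrFive ∣ starColours b₀ t₀ b₁ t₁ ∪ starColours b₁ t₁ b₂ t₂ ∣
cycleEdge-threeOrFive b₀ t₀ b₁ t₁ b₂ t₂ nz nz′ compatible =
  byExhaustion ∈-allBools P (λ { (b₀ ∷ t₀ ∷ b₁ ∷ t₁ ∷ b₂ ∷ t₂ ∷ []) → ThreeOrFive? _ }) premise _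
    (b₀ ∷ t₀ ∷ b₁ ∷ t₁ ∷ b₂ ∷ t₂ ∷ []) (T-∧-intro nz (T-∧-intro nz′ compatible))
  where
  P : Vec Bool 6 → Set
  P (b₀ ∷ t₀ ∷ b₁ ∷ t₁ ∷ b₂ ∷ t₂ ∷ []) = ThreeOrFive ∣ starColours b₀ t₀ b₁ t₁ ∪ starColours b₁ t₁ b₂ t₂ ∣
  premise : Vec Bool 6 → Bool
  premise (b₀ ∷ t₀ ∷ b₁ ∷ t₁ ∷ b₂ ∷ t₂ ∷ []) =
    Nonzero (b₀ xor b₁) (t₀ xor t₁) ∧ (Nonzero (b₁ xor b₂) (t₁ xor t₂) ∧
    Compatible (b₀ xor b₁) (t₀ xor t₁) (b₁ xor b₂) (t₁ xor t₂))

spokeEdge-threeOrFive : ∀ b₀ t₀ b₁ t₁ a₀ s₀ a₁ s₁ →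
  T (Nonzero (b₀ xor b₁) (t₀ xor t₁)) → b₀ xor b₁ ≡ a₀ xor a₁ → t₀ xor t₁ ≡ s₀ xor s₁ →
  ThreeOrFive ∣ starColours b₀ t₀ b₁ t₁ ∪ starColours a₀ s₀ a₁ s₁ ∣
spokeEdge-threeOrFive b₀ t₀ b₁ t₁ a₀ s₀ a₁ s₁ nz σ≡ d≡ =
  byExhaustion ∈-allBools P (λ { (b₀ ∷ t₀ ∷ b₁ ∷ t₁ ∷ a₀ ∷ s₀ ∷ a₁ ∷ s₁ ∷ []) → ThreeOrFive? _ }) premise _
    (b₀ ∷ t₀ ∷ b₁ ∷ t₁ ∷ a₀ ∷ s₀ ∷ a₁ ∷ s₁ ∷ []) (T-∧-intro nz (T-∧-intro (T-not-xor σ≡) (T-not-xor d≡)))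
  where
  P : Vec Bool 8 → Set
  P (b₀ ∷ t₀ ∷ b₁ ∷ t₁ ∷ a₀ ∷ s₀ ∷ a₁ ∷ s₁ ∷ []) = ThreeOrFive ∣ starColours b₀ t₀ b₁ t₁ ∪ starColours a₀ s₀ a₁ s₁ ∣
  premise : Vec Bool 8 → Bool
  premise (b₀ ∷ t₀ ∷ b₁ ∷ t₁ ∷ a₀ ∷ s₀ ∷ a₁ ∷ s₁ ∷ []) =
    Nonzero (b₀ xor b₁) (t₀ xor t₁) ∧ (not ((b₀ xor b₁) xor (a₀ xor a₁)) ∧ not ((t₀ xor t₁) xor (s₀ xor s₁)))

Δ : {n : ℕ} → (Fin n → Bool) → Fin n → Bool
Δ f j = f (prev j) xor f j

record Admissible {n : ℕ} (σ d : Fin n → Bool) : Set where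
  field
    nonzero    : ∀ j → T (Nonzero (σ j) (d j))
    compatible : ∀ j → T (Compatible (σ j) (d j) (σ (next j)) (d (next j)))

Admissible-resp : ∀ {n} {σ σ′ d d′ : Fin n → Bool} → (∀ j → σ j ≡ σ′ j) → (∀ j → d j ≡ d′ j) →
  Admissible σ d → Admissible σ′ d′
Admissible-resp {σ = σ} {σ′} {d} {d′} σ≗ d≗ adm = record { nonzero = nonzero′ ; compatible = compatible′ }
  where
  open Admissible adm
  nonzero′ : ∀ j → T (Nonzero (σ′ j) (d′ j))
  nonzero′ j rewrite sym (σ≗ j) | sym (d≗ j) = nonzero j
  compatible′ : ∀ j → T (Compatible (σ′ j) (d′ j) (σ′ (next j)) (d′ (next j)))
  compatible′ j rewrite sym (σ≗ j) | sym (d≗ j) | sym (σ≗ (next j)) | sym (d≗ (next j)) = compatible j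

record KleinLabelling {n : ℕ} (p : Permutation′ n) : Set where
  field
    bᵘ tᵘ bᵛ tᵛ : Fin n → Bool
    admissibleᵘ : Admissible (Δ bᵘ) (Δ tᵘ)
    admissibleᵛ : Admissible (Δ bᵛ) (Δ tᵛ)
    Δb-spoke    : ∀ i → Δ bᵛ i ≡ Δ bᵘ (p ⟨$⟩ʳ i)
    Δt-spoke    : ∀ i → Δ tᵛ i ≡ Δ tᵘ (p ⟨$⟩ʳ i)

star : {n : ℕ} → (b t : Fin n → Bool) → Fin n → Subset 6
star b t j = starColours (b (prev j)) (t (prev j)) (b j) (t j)

cycle-threeOrFive : ∀ {n} (b t : Fin n → Bool) → Admissible (Δ b) (Δ t) → ∀ j →
  ThreeOrFive ∣ star b t j ∪ star b t (next j) ∣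
cycle-threeOrFive b t adm j = edge (nonzero (next j)) (compatible j)
  where
  open Admissible adm
  edge : T (Nonzero (Δ b (next j)) (Δ t (next j))) →
         T (Compatible (Δ b j) (Δ t j) (Δ b (next j)) (Δ t (next j))) →
         ThreeOrFive ∣ star b t j ∪ star b t (next j) ∣
  edge rewrite prev-next j =
    cycleEdge-threeOrFive (b (prev j)) (t (prev j)) (b j) (t j) (b (next j)) (t (next j)) (nonzero j)

module _ {n : ℕ} {p : Permutation′ n} (L : KleinLabelling p) where
  open KleinLabelling L

  kleinLocallyNormal : LocallyNormal (p ⟨$⟩ʳ_) (λ j → cycleColour (bᵘ j) (tᵘ j))
                         (λ i → cycleColour (bᵛ i) (tᵛ i)) (λ j → spokeColour (Δ bᵘ j))
  kleinLocallyNormal =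
    (λ j → star-distinct _ _ _ _ (nonzeroᵘ j) , cycle-threeOrFive bᵘ tᵘ admissibleᵘ j) ,
    (λ i → subst₂ (AtV i) (spokeColour-spoke i) (spokeColour-spoke (next i))
             ( star-distinct _ _ _ _ (nonzeroᵛ i)
             , cycle-threeOrFive bᵛ tᵛ admissibleᵛ i
             , spokeEdge-threeOrFive (bᵛ (prev i)) (tᵛ (prev i)) (bᵛ i) (tᵛ i)
                 (bᵘ (prev (p ⟨$⟩ʳ i))) (tᵘ (prev (p ⟨$⟩ʳ i))) (bᵘ (p ⟨$⟩ʳ i)) (tᵘ (p ⟨$⟩ʳ i))
                 (nonzeroᵛ i) (Δb-spoke i) (Δt-spoke i)))
    where
    open Admissible admissibleᵘ using () renaming (nonzero to nonzeroᵘ)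
    open Admissible admissibleᵛ using () renaming (nonzero to nonzeroᵛ)

    V : Fin n → Fin 6
    V i = cycleColour (bᵛ i) (tᵛ i)

    AtV : Fin n → Fin 6 → Fin 6 → Set
    AtV i s s′ = Distinct₃ (V i) (V (prev i)) s ×
      ThreeOrFive ∣ (⁅ V i ⁆ ∪ (⁅ V (prev i) ⁆ ∪ ⁅ s ⁆)) ∪ (⁅ V (next i) ⁆ ∪ (⁅ V (prev (next i)) ⁆ ∪ ⁅ s′ ⁆)) ∣ ×
      ThreeOrFive ∣ (⁅ V i ⁆ ∪ (⁅ V (prev i) ⁆ ∪ ⁅ s ⁆)) ∪ star bᵘ tᵘ (p ⟨$⟩ʳ i) ∣

    spokeColour-spoke : ∀ i → spokeColour (Δ bᵛ i) ≡ spokeColour (Δ bᵘ (p ⟨$⟩ʳ i))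
    spokeColour-spoke i = cong spokeColour (Δb-spoke i)

fromKleinLabelling : ∀ {n} {p : Permutation′ n} → KleinLabelling p → Σ (Coloring n 6) (NormalColoring p)
fromKleinLabelling {p = p} L =
  explicitColouring p _ _ _ , explicitColouring-normal p _ _ _ (kleinLocallyNormal L)

infix 4 _≡ᵇ_ _≤ᵇ_

_≡ᵇ_ : {n : ℕ} → Fin n → Fin n → Bool
i ≡ᵇ j = does (i ≟ j)

_≤ᵇ_ : {n : ℕ} → Fin n → Fin n → Bool
i ≤ᵇ j = does (i ≤? j)

xor-cancel : ∀ z x y → (z xor x) xor (z xor y) ≡ x xor y
xor-cancel z x y = trans (interchange z x z y) (cong (_xor (x xor y)) (xor-same z))

not-xor-cancel : ∀ z x → not z xor (z xor x) ≡ not x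
not-xor-cancel z x = trans (sym (xor-assoc (not z) z x)) (cong (_xor x) (xor-inverseˡ z))

Δ-xor : ∀ {n} (f g : Fin n → Bool) j → Δ (λ i → f i xor g i) j ≡ Δ f j xor Δ g j
Δ-xor f g j = interchange (f (prev j)) (g (prev j)) (f j) (g j)

Δ-≤ᵇ : ∀ {m} (a j : Fin (suc m)) → Δ (a ≤ᵇ_) j ≡ (j ≡ᵇ zero) xor (j ≡ᵇ a)
Δ-≤ᵇ a zero rewrite dec-true (a ≤? fromℕ _) (≤fromℕ a) with a
... | zero  = refl
... | suc _ = refl
Δ-≤ᵇ a (suc k) with ℕ.<-cmp (toℕ a) (suc (toℕ k))
... | tri< a<k+1 a≢k+1 _
  rewrite dec-true (a ≤? inject₁ k) (subst (toℕ a ℕ.≤_) (sym (toℕ-inject₁ k)) (ℕ.≤-pred a<k+1))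
        | dec-true (a ≤? suc k) (ℕ.<⇒≤ a<k+1)
        | dec-false (suc k ≟ a) (a≢k+1 ∘ cong toℕ ∘ sym) = refl
... | tri≈ _ a≡k+1 _
  rewrite dec-false (a ≤? inject₁ k) (λ a≤k → ℕ.1+n≰n (subst₂ ℕ._≤_ a≡k+1 (toℕ-inject₁ k) a≤k))
        | dec-true (a ≤? suc k) (ℕ.≤-reflexive a≡k+1)
        | dec-true (suc k ≟ a) (toℕ-injective (sym a≡k+1)) = refl
... | tri> _ a≢k+1 k+1<a
  rewrite dec-false (a ≤? inject₁ k) (λ a≤k → ℕ.<⇒≱ k+1<a (ℕ.m≤n⇒m≤1+n (subst (toℕ a ℕ.≤_) (toℕ-inject₁ k) a≤k)))
        | dec-false (a ≤? suc k) (ℕ.<⇒≱ k+1<a)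
        | dec-false (suc k ≟ a) (a≢k+1 ∘ cong toℕ ∘ sym) = refl

odd : ℕ → Bool
odd zero    = false
odd (suc k) = not (odd k)

alternating : {n : ℕ} → Fin n → Bool
alternating j = odd (toℕ j)

Δ-alternating : ∀ {m} (j : Fin (suc m)) → Δ alternating j ≡ not (j ≡ᵇ zero) ∨ odd m
Δ-alternating {m} zero    rewrite toℕ-fromℕ m = xor-identityʳ (odd m)
Δ-alternating     (suc k) rewrite toℕ-inject₁ k = xor-inverseʳ (odd (toℕ k))

module _ {n : ℕ} {a b : Fin n} (b≢a : b ≢ a) (b≢next : b ≢ next a) (b≢prev : b ≢ prev a) where

  singleDefect-admissible : Admissible (λ j → (j ≡ᵇ a) xor (j ≡ᵇ b)) (λ j → not (j ≡ᵇ a))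
  singleDefect-admissible = record { nonzero = nonzero ; compatible = compatible }
    where
    nonzero : ∀ j → T (Nonzero ((j ≡ᵇ a) xor (j ≡ᵇ b)) (not (j ≡ᵇ a)))
    nonzero j with j ≟ a
    ... | yes refl rewrite dec-false (j ≟ b) (b≢a ∘ sym) = _
    ... | no _     = _

    compatible : ∀ j → T (Compatible ((j ≡ᵇ a) xor (j ≡ᵇ b)) (not (j ≡ᵇ a))
                                     ((next j ≡ᵇ a) xor (next j ≡ᵇ b)) (not (next j ≡ᵇ a)))
    compatible j with j ≟ a | next j ≟ a
    ... | yes refl | yes _ = _
    ... | yes refl | no _
      rewrite dec-false (j ≟ b) (b≢a ∘ sym) | dec-false (next j ≟ b) (b≢next ∘ sym) = _
    ... | no _     | yes refl
      rewrite dec-false (j ≟ b) (λ j≡b → b≢prev (trans (sym j≡b) (sym (prev-next j))))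
            | dec-false (next j ≟ b) (b≢a ∘ sym) = _
    ... | no _     | no _ = _

permute-≡ᵇ : ∀ {n} (p : Permutation′ n) i a → (p ⟨$⟩ʳ i ≡ᵇ a) ≡ (i ≡ᵇ p ⟨$⟩ˡ a)
permute-≡ᵇ p i a = does-⇔ (mk⇔ (λ { refl → sym (inverseˡ p) }) (λ { refl → inverseʳ p })) (p ⟨$⟩ʳ i ≟ a) (i ≟ p ⟨$⟩ˡ a)

evenLabelling : ∀ {m} → odd m ≡ true → (p : Permutation′ (suc m)) → KleinLabelling p
evenLabelling {m} m-odd p = record
  { bᵘ = λ _ → false ; tᵘ = alternating ; bᵛ = λ _ → false ; tᵛ = alternating
  ; admissibleᵘ = admissible ; admissibleᵛ = admissible
  ; Δb-spoke    = λ _ → refl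
  ; Δt-spoke    = λ i → trans (Δalternating≡true i) (sym (Δalternating≡true (p ⟨$⟩ʳ i)))
  }
  where
  Δalternating≡true : ∀ j → Δ alternating j ≡ true
  Δalternating≡true j = trans (Δ-alternating {m} j) (trans (cong (not (j ≡ᵇ zero) ∨_) m-odd) (∨-zeroʳ _))
  admissible : Admissible (Δ (λ _ → false)) (Δ alternating)
  admissible = Admissible-resp (λ _ → refl) (sym ∘ Δalternating≡true) (record { nonzero = _ ; compatible = _ })

-- With c = p⁻¹ 0 and f = p⁻¹ e: δ = (1, 0) at u₀ and v_c, δ = (1, 1) at u_e and v_f, and δ = (0, 1)
-- elsewhere.
module _ {m : ℕ} (m-even : odd m ≡ false) (p : Permutation′ (suc m)) (e : Fin (suc m))
         (e≢0 : e ≢ zero) (e≢next0 : e ≢ next zero) (e≢prev0 : e ≢ prev zero)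
         (e≢p[next-c] : e ≢ p ⟨$⟩ʳ next (p ⟨$⟩ˡ zero)) (e≢p[prev-c] : e ≢ p ⟨$⟩ʳ prev (p ⟨$⟩ˡ zero)) where

  private
    c f : Fin (suc m)
    c = p ⟨$⟩ˡ zero
    f = p ⟨$⟩ˡ e

    f≢ : ∀ {x} → e ≢ p ⟨$⟩ʳ x → f ≢ x
    f≢ e≢px f≡x = e≢px (trans (sym (inverseʳ p)) (cong (p ⟨$⟩ʳ_) f≡x))

    Δalternating : ∀ j → Δ alternating j ≡ not (j ≡ᵇ zero)
    Δalternating j = trans (Δ-alternating {m} j) (trans (cong (not (j ≡ᵇ zero) ∨_) m-even) (∨-identityʳ _))

    Δbᵛ : ∀ i → Δ (λ i → (c ≤ᵇ i) xor (f ≤ᵇ i)) i ≡ (i ≡ᵇ c) xor (i ≡ᵇ f)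
    Δbᵛ i = trans (Δ-xor (c ≤ᵇ_) (f ≤ᵇ_) i)
      (trans (cong₂ _xor_ (Δ-≤ᵇ c i) (Δ-≤ᵇ f i)) (xor-cancel (i ≡ᵇ zero) (i ≡ᵇ c) (i ≡ᵇ f)))

    Δtᵛ : ∀ i → Δ (λ i → alternating i xor (c ≤ᵇ i)) i ≡ not (i ≡ᵇ c)
    Δtᵛ i = trans (Δ-xor alternating (c ≤ᵇ_) i)
      (trans (cong₂ _xor_ (Δalternating i) (Δ-≤ᵇ c i)) (not-xor-cancel (i ≡ᵇ zero) (i ≡ᵇ c)))

  oddLabelling : KleinLabelling p
  oddLabelling = record
    { bᵘ = e ≤ᵇ_ ; tᵘ = alternating
    ; bᵛ = λ i → (c ≤ᵇ i) xor (f ≤ᵇ i) ; tᵛ = λ i → alternating i xor (c ≤ᵇ i)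
    ; admissibleᵘ = Admissible-resp (sym ∘ Δ-≤ᵇ e) (sym ∘ Δalternating)
        (singleDefect-admissible e≢0 e≢next0 e≢prev0)
    ; admissibleᵛ = Admissible-resp (sym ∘ Δbᵛ) (sym ∘ Δtᵛ)
        (singleDefect-admissible (f≢ (subst (e ≢_) (sym (inverseʳ p)) e≢0)) (f≢ e≢p[next-c]) (f≢ e≢p[prev-c]))
    ; Δb-spoke = λ i → trans (Δbᵛ i) (sym (trans (Δ-≤ᵇ e (p ⟨$⟩ʳ i))
        (cong₂ _xor_ (permute-≡ᵇ p i zero) (permute-≡ᵇ p i e))))
    ; Δt-spoke = λ i → trans (Δtᵛ i) (sym (trans (Δalternating (p ⟨$⟩ʳ i)) (cong not (permute-≡ᵇ p i zero))))
    }

oneOfThreeAvoids : {A : Set} {P : A → Set} → DecidableEquality A → ∀ {x y z} →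
  x ≢ y → x ≢ z → y ≢ z → P x → P y → P z → ∀ q r → ∃[ w ] P w × w ≢ q × w ≢ r
oneOfThreeAvoids _≟_ {x} {y} {z} x≢y x≢z y≢z px py pz q r with x ≟ q | x ≟ r
... | no x≢q | no x≢r = x , px , x≢q , x≢r
... | yes refl | _ with y ≟ r
...   | no y≢r   = y , py , x≢y ∘′ sym , y≢r
...   | yes refl = z , pz , x≢z ∘′ sym , y≢z ∘′ sym
oneOfThreeAvoids _≟_ {x} {y} {z} x≢y x≢z y≢z px py pz q r | no _ | yes refl with y ≟ q
...   | no y≢q   = y , py , y≢q , x≢y ∘′ sym
...   | yes refl = z , pz , y≢z ∘′ sym , x≢z ∘′ sym

AwayFromZero : ∀ {n} → Fin n → Set
AwayFromZero {suc m} w = w ≢ zero × w ≢ next zero × w ≢ prev zero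

awayFromZero : ∀ {m} (w : Fin (suc (suc m))) → w ≢ zero → w ≢ 1F → w ≢ prev zero → AwayFromZero w
awayFromZero w w≢0 w≢1 w≢last = w≢0 , (λ w≡next0 → w≢1 (trans w≡next0 next-zero)) , w≢last

oddLabelling-exists : ∀ k → odd (6 + k) ≡ false → (p : Permutation′ (7 + k)) → KleinLabelling p
oddLabelling-exists k m-even p
  with e , (e≢0 , e≢next0 , e≢prev0) , e≢p[next-c] , e≢p[prev-c]
         ← oneOfThreeAvoids {P = AwayFromZero} _≟_ (λ ()) (λ ()) (λ ())
             (awayFromZero 2F (λ ()) (λ ()) (λ ()))
             (awayFromZero 3F (λ ()) (λ ()) (λ ()))
             (awayFromZero 4F (λ ()) (λ ()) (λ ()))
             (p ⟨$⟩ʳ next (p ⟨$⟩ˡ zero)) (p ⟨$⟩ʳ prev (p ⟨$⟩ˡ zero))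
  = oddLabelling m-even p e e≢0 e≢next0 e≢prev0 e≢p[next-c] e≢p[prev-c]

Certificate : ℕ → Set
Certificate N = Vec (Fin N) N → Vec (Fin 6) N × Vec (Fin 6) N × Vec (Fin 6) N

module _ {N : ℕ} (certificate : Certificate N) where

  private
    Valid : Vec (Fin N) N → Set
    Valid t = LocallyNormal (lookup t) (lookup (proj₁ (certificate t)))
                (lookup (proj₁ (proj₂ (certificate t)))) (lookup (proj₂ (proj₂ (certificate t))))

    valid? : ∀ t → Dec (Valid t)
    valid? t = locallyNormal? _ _ _ _

    injective? : (t : Vec (Fin N) N) → Dec (∀ i j → lookup t i ≡ lookup t j → i ≡ j)
    injective? t = all? λ i → all? λ j → (lookup t i ≟ lookup t j) →-dec (i ≟ j)

  Verified : Set
  Verified = T (allVectors (allFin N) N (λ t → if isYes (injective? t) then isYes (valid? t) else true))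

  certifiedColouring : Verified → (p : Permutation′ N) → Σ (Coloring N 6) (NormalColoring p)
  certifiedColouring verified p =
    explicitColouring p U V W ,
    explicitColouring-normal p U V W (LocallyNormal-resp (lookup∘tabulate _) valid)
    where
    table : Vec (Fin N) N
    table = tabulate (p ⟨$⟩ʳ_)
    U V W : Fin N → Fin 6
    U = lookup (proj₁ (certificate table))
    V = lookup (proj₁ (proj₂ (certificate table)))
    W = lookup (proj₂ (proj₂ (certificate table)))

    table-injective : ∀ i j → lookup table i ≡ lookup table j → i ≡ j
    table-injective i j eq rewrite lookup∘tabulate (p ⟨$⟩ʳ_) i | lookup∘tabulate (p ⟨$⟩ʳ_) j =
      trans (sym (inverseˡ p)) (trans (cong (p ⟨$⟩ˡ_) eq) (inverseˡ p))

    valid : Valid table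
    valid = byExhaustion ∈-allFin Valid valid? (λ t → isYes (injective? t)) verified table
      (fromWitness table-injective)

-- Found by computer search; for n = 5 all tables except the ten giving the Petersen graph are
-- 3-edge-colourings.
certificate₃ : Certificate 3
certificate₃ (0F ∷ 1F ∷ 2F ∷ []) = (0F ∷ 1F ∷ 2F ∷ []) , (0F ∷ 1F ∷ 2F ∷ []) , (1F ∷ 2F ∷ 0F ∷ [])
certificate₃ (0F ∷ 2F ∷ 1F ∷ []) = (0F ∷ 1F ∷ 2F ∷ []) , (2F ∷ 1F ∷ 0F ∷ []) , (1F ∷ 2F ∷ 0F ∷ [])
certificate₃ (1F ∷ 0F ∷ 2F ∷ []) = (0F ∷ 1F ∷ 2F ∷ []) , (0F ∷ 2F ∷ 1F ∷ []) , (1F ∷ 2F ∷ 0F ∷ [])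
certificate₃ (1F ∷ 2F ∷ 0F ∷ []) = (0F ∷ 1F ∷ 2F ∷ []) , (1F ∷ 2F ∷ 0F ∷ []) , (1F ∷ 2F ∷ 0F ∷ [])
certificate₃ (2F ∷ 0F ∷ 1F ∷ []) = (0F ∷ 1F ∷ 2F ∷ []) , (2F ∷ 0F ∷ 1F ∷ []) , (1F ∷ 2F ∷ 0F ∷ [])
certificate₃ (2F ∷ 1F ∷ 0F ∷ []) = (0F ∷ 1F ∷ 2F ∷ []) , (1F ∷ 0F ∷ 2F ∷ []) , (1F ∷ 2F ∷ 0F ∷ [])
certificate₃ _ = replicate 3 0F , replicate 3 0F , replicate 3 0F

certificate₅ : Certificate 5
certificate₅ (0F ∷ 1F ∷ 2F ∷ 3F ∷ 4F ∷ []) = (0F ∷ 1F ∷ 0F ∷ 1F ∷ 2F ∷ []) , (0F ∷ 1F ∷ 0F ∷ 1F ∷ 2F ∷ []) , (1F ∷ 2F ∷ 2F ∷ 2F ∷ 0F ∷ [])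
certificate₅ (0F ∷ 1F ∷ 2F ∷ 4F ∷ 3F ∷ []) = (0F ∷ 1F ∷ 0F ∷ 2F ∷ 1F ∷ []) , (1F ∷ 0F ∷ 1F ∷ 2F ∷ 0F ∷ []) , (2F ∷ 2F ∷ 2F ∷ 1F ∷ 0F ∷ [])
certificate₅ (0F ∷ 1F ∷ 3F ∷ 2F ∷ 4F ∷ []) = (0F ∷ 1F ∷ 0F ∷ 1F ∷ 2F ∷ []) , (0F ∷ 1F ∷ 0F ∷ 1F ∷ 2F ∷ []) , (1F ∷ 2F ∷ 2F ∷ 2F ∷ 0F ∷ [])
certificate₅ (0F ∷ 1F ∷ 3F ∷ 4F ∷ 2F ∷ []) = (0F ∷ 1F ∷ 0F ∷ 2F ∷ 1F ∷ []) , (1F ∷ 0F ∷ 2F ∷ 1F ∷ 0F ∷ []) , (2F ∷ 2F ∷ 2F ∷ 1F ∷ 0F ∷ [])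
certificate₅ (0F ∷ 1F ∷ 4F ∷ 2F ∷ 3F ∷ []) = (0F ∷ 1F ∷ 2F ∷ 0F ∷ 1F ∷ []) , (1F ∷ 0F ∷ 1F ∷ 2F ∷ 0F ∷ []) , (2F ∷ 2F ∷ 0F ∷ 1F ∷ 2F ∷ [])
certificate₅ (0F ∷ 1F ∷ 4F ∷ 3F ∷ 2F ∷ []) = (0F ∷ 1F ∷ 0F ∷ 2F ∷ 1F ∷ []) , (0F ∷ 1F ∷ 2F ∷ 0F ∷ 1F ∷ []) , (2F ∷ 2F ∷ 2F ∷ 1F ∷ 0F ∷ [])
certificate₅ (0F ∷ 2F ∷ 1F ∷ 3F ∷ 4F ∷ []) = (0F ∷ 1F ∷ 0F ∷ 1F ∷ 2F ∷ []) , (0F ∷ 1F ∷ 0F ∷ 1F ∷ 2F ∷ []) , (1F ∷ 2F ∷ 2F ∷ 2F ∷ 0F ∷ [])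
certificate₅ (0F ∷ 2F ∷ 1F ∷ 4F ∷ 3F ∷ []) = (0F ∷ 1F ∷ 0F ∷ 2F ∷ 1F ∷ []) , (1F ∷ 0F ∷ 1F ∷ 2F ∷ 0F ∷ []) , (2F ∷ 2F ∷ 2F ∷ 1F ∷ 0F ∷ [])
certificate₅ (0F ∷ 2F ∷ 3F ∷ 1F ∷ 4F ∷ []) = (0F ∷ 1F ∷ 0F ∷ 1F ∷ 2F ∷ []) , (0F ∷ 1F ∷ 0F ∷ 1F ∷ 2F ∷ []) , (1F ∷ 2F ∷ 2F ∷ 2F ∷ 0F ∷ [])
certificate₅ (0F ∷ 2F ∷ 3F ∷ 4F ∷ 1F ∷ []) = (0F ∷ 1F ∷ 0F ∷ 2F ∷ 1F ∷ []) , (1F ∷ 0F ∷ 2F ∷ 1F ∷ 0F ∷ []) , (2F ∷ 2F ∷ 2F ∷ 1F ∷ 0F ∷ [])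
certificate₅ (0F ∷ 2F ∷ 4F ∷ 1F ∷ 3F ∷ []) = (0F ∷ 1F ∷ 2F ∷ 3F ∷ 4F ∷ []) , (3F ∷ 0F ∷ 2F ∷ 4F ∷ 1F ∷ []) , (2F ∷ 3F ∷ 4F ∷ 0F ∷ 1F ∷ [])
certificate₅ (0F ∷ 2F ∷ 4F ∷ 3F ∷ 1F ∷ []) = (0F ∷ 1F ∷ 0F ∷ 2F ∷ 1F ∷ []) , (0F ∷ 1F ∷ 2F ∷ 0F ∷ 1F ∷ []) , (2F ∷ 2F ∷ 2F ∷ 1F ∷ 0F ∷ [])
certificate₅ (0F ∷ 3F ∷ 1F ∷ 2F ∷ 4F ∷ []) = (0F ∷ 1F ∷ 0F ∷ 1F ∷ 2F ∷ []) , (0F ∷ 1F ∷ 0F ∷ 1F ∷ 2F ∷ []) , (1F ∷ 2F ∷ 2F ∷ 2F ∷ 0F ∷ [])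
certificate₅ (0F ∷ 3F ∷ 1F ∷ 4F ∷ 2F ∷ []) = (0F ∷ 1F ∷ 2F ∷ 3F ∷ 4F ∷ []) , (1F ∷ 4F ∷ 2F ∷ 0F ∷ 3F ∷ []) , (2F ∷ 3F ∷ 4F ∷ 0F ∷ 1F ∷ [])
certificate₅ (0F ∷ 3F ∷ 2F ∷ 1F ∷ 4F ∷ []) = (0F ∷ 1F ∷ 0F ∷ 1F ∷ 2F ∷ []) , (0F ∷ 1F ∷ 0F ∷ 1F ∷ 2F ∷ []) , (1F ∷ 2F ∷ 2F ∷ 2F ∷ 0F ∷ [])
certificate₅ (0F ∷ 3F ∷ 2F ∷ 4F ∷ 1F ∷ []) = (0F ∷ 1F ∷ 2F ∷ 0F ∷ 1F ∷ []) , (0F ∷ 2F ∷ 1F ∷ 0F ∷ 1F ∷ []) , (2F ∷ 2F ∷ 0F ∷ 1F ∷ 2F ∷ [])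
certificate₅ (0F ∷ 3F ∷ 4F ∷ 1F ∷ 2F ∷ []) = (0F ∷ 1F ∷ 0F ∷ 2F ∷ 1F ∷ []) , (0F ∷ 2F ∷ 1F ∷ 0F ∷ 1F ∷ []) , (2F ∷ 2F ∷ 2F ∷ 1F ∷ 0F ∷ [])
certificate₅ (0F ∷ 3F ∷ 4F ∷ 2F ∷ 1F ∷ []) = (0F ∷ 1F ∷ 0F ∷ 2F ∷ 1F ∷ []) , (0F ∷ 2F ∷ 1F ∷ 0F ∷ 1F ∷ []) , (2F ∷ 2F ∷ 2F ∷ 1F ∷ 0F ∷ [])
certificate₅ (0F ∷ 4F ∷ 1F ∷ 2F ∷ 3F ∷ []) = (0F ∷ 1F ∷ 0F ∷ 1F ∷ 2F ∷ []) , (2F ∷ 1F ∷ 0F ∷ 1F ∷ 0F ∷ []) , (1F ∷ 2F ∷ 2F ∷ 2F ∷ 0F ∷ [])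
certificate₅ (0F ∷ 4F ∷ 1F ∷ 3F ∷ 2F ∷ []) = (0F ∷ 1F ∷ 0F ∷ 1F ∷ 2F ∷ []) , (2F ∷ 1F ∷ 0F ∷ 1F ∷ 0F ∷ []) , (1F ∷ 2F ∷ 2F ∷ 2F ∷ 0F ∷ [])
certificate₅ (0F ∷ 4F ∷ 2F ∷ 1F ∷ 3F ∷ []) = (0F ∷ 1F ∷ 0F ∷ 1F ∷ 2F ∷ []) , (2F ∷ 1F ∷ 0F ∷ 1F ∷ 0F ∷ []) , (1F ∷ 2F ∷ 2F ∷ 2F ∷ 0F ∷ [])
certificate₅ (0F ∷ 4F ∷ 2F ∷ 3F ∷ 1F ∷ []) = (0F ∷ 1F ∷ 0F ∷ 1F ∷ 2F ∷ []) , (2F ∷ 1F ∷ 0F ∷ 1F ∷ 0F ∷ []) , (1F ∷ 2F ∷ 2F ∷ 2F ∷ 0F ∷ [])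
certificate₅ (0F ∷ 4F ∷ 3F ∷ 1F ∷ 2F ∷ []) = (0F ∷ 1F ∷ 0F ∷ 1F ∷ 2F ∷ []) , (2F ∷ 1F ∷ 0F ∷ 1F ∷ 0F ∷ []) , (1F ∷ 2F ∷ 2F ∷ 2F ∷ 0F ∷ [])
certificate₅ (0F ∷ 4F ∷ 3F ∷ 2F ∷ 1F ∷ []) = (0F ∷ 1F ∷ 0F ∷ 1F ∷ 2F ∷ []) , (2F ∷ 1F ∷ 0F ∷ 1F ∷ 0F ∷ []) , (1F ∷ 2F ∷ 2F ∷ 2F ∷ 0F ∷ [])
certificate₅ (1F ∷ 0F ∷ 2F ∷ 3F ∷ 4F ∷ []) = (0F ∷ 1F ∷ 0F ∷ 2F ∷ 1F ∷ []) , (0F ∷ 1F ∷ 0F ∷ 2F ∷ 1F ∷ []) , (2F ∷ 2F ∷ 2F ∷ 1F ∷ 0F ∷ [])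
certificate₅ (1F ∷ 0F ∷ 2F ∷ 4F ∷ 3F ∷ []) = (0F ∷ 1F ∷ 0F ∷ 2F ∷ 1F ∷ []) , (1F ∷ 0F ∷ 1F ∷ 2F ∷ 0F ∷ []) , (2F ∷ 2F ∷ 2F ∷ 1F ∷ 0F ∷ [])
certificate₅ (1F ∷ 0F ∷ 3F ∷ 2F ∷ 4F ∷ []) = (0F ∷ 1F ∷ 2F ∷ 0F ∷ 1F ∷ []) , (1F ∷ 0F ∷ 2F ∷ 1F ∷ 0F ∷ []) , (2F ∷ 2F ∷ 0F ∷ 1F ∷ 2F ∷ [])
certificate₅ (1F ∷ 0F ∷ 3F ∷ 4F ∷ 2F ∷ []) = (0F ∷ 1F ∷ 0F ∷ 2F ∷ 1F ∷ []) , (1F ∷ 0F ∷ 2F ∷ 1F ∷ 0F ∷ []) , (2F ∷ 2F ∷ 2F ∷ 1F ∷ 0F ∷ [])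
certificate₅ (1F ∷ 0F ∷ 4F ∷ 2F ∷ 3F ∷ []) = (0F ∷ 1F ∷ 0F ∷ 1F ∷ 2F ∷ []) , (0F ∷ 2F ∷ 1F ∷ 0F ∷ 1F ∷ []) , (1F ∷ 2F ∷ 2F ∷ 2F ∷ 0F ∷ [])
certificate₅ (1F ∷ 0F ∷ 4F ∷ 3F ∷ 2F ∷ []) = (0F ∷ 1F ∷ 0F ∷ 1F ∷ 2F ∷ []) , (0F ∷ 2F ∷ 1F ∷ 0F ∷ 1F ∷ []) , (1F ∷ 2F ∷ 2F ∷ 2F ∷ 0F ∷ [])
certificate₅ (1F ∷ 2F ∷ 0F ∷ 3F ∷ 4F ∷ []) = (0F ∷ 1F ∷ 0F ∷ 2F ∷ 1F ∷ []) , (0F ∷ 1F ∷ 0F ∷ 2F ∷ 1F ∷ []) , (2F ∷ 2F ∷ 2F ∷ 1F ∷ 0F ∷ [])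
certificate₅ (1F ∷ 2F ∷ 0F ∷ 4F ∷ 3F ∷ []) = (0F ∷ 1F ∷ 0F ∷ 1F ∷ 2F ∷ []) , (1F ∷ 0F ∷ 2F ∷ 1F ∷ 0F ∷ []) , (1F ∷ 2F ∷ 2F ∷ 2F ∷ 0F ∷ [])
certificate₅ (1F ∷ 2F ∷ 3F ∷ 0F ∷ 4F ∷ []) = (0F ∷ 1F ∷ 0F ∷ 1F ∷ 2F ∷ []) , (0F ∷ 1F ∷ 0F ∷ 2F ∷ 1F ∷ []) , (1F ∷ 2F ∷ 2F ∷ 2F ∷ 0F ∷ [])
certificate₅ (1F ∷ 2F ∷ 3F ∷ 4F ∷ 0F ∷ []) = (0F ∷ 1F ∷ 0F ∷ 1F ∷ 2F ∷ []) , (1F ∷ 0F ∷ 1F ∷ 2F ∷ 0F ∷ []) , (1F ∷ 2F ∷ 2F ∷ 2F ∷ 0F ∷ [])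
certificate₅ (1F ∷ 2F ∷ 4F ∷ 0F ∷ 3F ∷ []) = (0F ∷ 1F ∷ 0F ∷ 1F ∷ 2F ∷ []) , (0F ∷ 1F ∷ 2F ∷ 0F ∷ 1F ∷ []) , (1F ∷ 2F ∷ 2F ∷ 2F ∷ 0F ∷ [])
certificate₅ (1F ∷ 2F ∷ 4F ∷ 3F ∷ 0F ∷ []) = (0F ∷ 1F ∷ 0F ∷ 2F ∷ 1F ∷ []) , (0F ∷ 1F ∷ 2F ∷ 0F ∷ 1F ∷ []) , (2F ∷ 2F ∷ 2F ∷ 1F ∷ 0F ∷ [])
certificate₅ (1F ∷ 3F ∷ 0F ∷ 2F ∷ 4F ∷ []) = (0F ∷ 1F ∷ 2F ∷ 3F ∷ 4F ∷ []) , (4F ∷ 1F ∷ 3F ∷ 0F ∷ 2F ∷ []) , (2F ∷ 3F ∷ 4F ∷ 0F ∷ 1F ∷ [])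
certificate₅ (1F ∷ 3F ∷ 0F ∷ 4F ∷ 2F ∷ []) = (0F ∷ 1F ∷ 0F ∷ 1F ∷ 2F ∷ []) , (1F ∷ 0F ∷ 2F ∷ 1F ∷ 0F ∷ []) , (1F ∷ 2F ∷ 2F ∷ 2F ∷ 0F ∷ [])
certificate₅ (1F ∷ 3F ∷ 2F ∷ 0F ∷ 4F ∷ []) = (0F ∷ 1F ∷ 0F ∷ 1F ∷ 2F ∷ []) , (0F ∷ 1F ∷ 0F ∷ 2F ∷ 1F ∷ []) , (1F ∷ 2F ∷ 2F ∷ 2F ∷ 0F ∷ [])
certificate₅ (1F ∷ 3F ∷ 2F ∷ 4F ∷ 0F ∷ []) = (0F ∷ 1F ∷ 0F ∷ 1F ∷ 2F ∷ []) , (1F ∷ 0F ∷ 1F ∷ 2F ∷ 0F ∷ []) , (1F ∷ 2F ∷ 2F ∷ 2F ∷ 0F ∷ [])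
certificate₅ (1F ∷ 3F ∷ 4F ∷ 0F ∷ 2F ∷ []) = (0F ∷ 1F ∷ 0F ∷ 1F ∷ 2F ∷ []) , (0F ∷ 1F ∷ 2F ∷ 0F ∷ 1F ∷ []) , (1F ∷ 2F ∷ 2F ∷ 2F ∷ 0F ∷ [])
certificate₅ (1F ∷ 3F ∷ 4F ∷ 2F ∷ 0F ∷ []) = (0F ∷ 1F ∷ 0F ∷ 2F ∷ 1F ∷ []) , (0F ∷ 2F ∷ 1F ∷ 0F ∷ 1F ∷ []) , (2F ∷ 2F ∷ 2F ∷ 1F ∷ 0F ∷ [])
certificate₅ (1F ∷ 4F ∷ 0F ∷ 2F ∷ 3F ∷ []) = (0F ∷ 1F ∷ 0F ∷ 1F ∷ 2F ∷ []) , (1F ∷ 2F ∷ 0F ∷ 1F ∷ 0F ∷ []) , (1F ∷ 2F ∷ 2F ∷ 2F ∷ 0F ∷ [])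
certificate₅ (1F ∷ 4F ∷ 0F ∷ 3F ∷ 2F ∷ []) = (0F ∷ 1F ∷ 0F ∷ 1F ∷ 2F ∷ []) , (1F ∷ 2F ∷ 0F ∷ 1F ∷ 0F ∷ []) , (1F ∷ 2F ∷ 2F ∷ 2F ∷ 0F ∷ [])
certificate₅ (1F ∷ 4F ∷ 2F ∷ 0F ∷ 3F ∷ []) = (0F ∷ 1F ∷ 2F ∷ 3F ∷ 4F ∷ []) , (2F ∷ 0F ∷ 3F ∷ 1F ∷ 4F ∷ []) , (2F ∷ 3F ∷ 4F ∷ 0F ∷ 1F ∷ [])
certificate₅ (1F ∷ 4F ∷ 2F ∷ 3F ∷ 0F ∷ []) = (0F ∷ 1F ∷ 2F ∷ 0F ∷ 1F ∷ []) , (0F ∷ 1F ∷ 2F ∷ 0F ∷ 1F ∷ []) , (2F ∷ 2F ∷ 0F ∷ 1F ∷ 2F ∷ [])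
certificate₅ (1F ∷ 4F ∷ 3F ∷ 0F ∷ 2F ∷ []) = (0F ∷ 1F ∷ 0F ∷ 2F ∷ 1F ∷ []) , (1F ∷ 2F ∷ 0F ∷ 1F ∷ 0F ∷ []) , (2F ∷ 2F ∷ 2F ∷ 1F ∷ 0F ∷ [])
certificate₅ (1F ∷ 4F ∷ 3F ∷ 2F ∷ 0F ∷ []) = (0F ∷ 1F ∷ 0F ∷ 2F ∷ 1F ∷ []) , (1F ∷ 2F ∷ 0F ∷ 1F ∷ 0F ∷ []) , (2F ∷ 2F ∷ 2F ∷ 1F ∷ 0F ∷ [])
certificate₅ (2F ∷ 0F ∷ 1F ∷ 3F ∷ 4F ∷ []) = (0F ∷ 1F ∷ 0F ∷ 2F ∷ 1F ∷ []) , (0F ∷ 1F ∷ 0F ∷ 2F ∷ 1F ∷ []) , (2F ∷ 2F ∷ 2F ∷ 1F ∷ 0F ∷ [])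
certificate₅ (2F ∷ 0F ∷ 1F ∷ 4F ∷ 3F ∷ []) = (0F ∷ 1F ∷ 0F ∷ 2F ∷ 1F ∷ []) , (1F ∷ 0F ∷ 1F ∷ 2F ∷ 0F ∷ []) , (2F ∷ 2F ∷ 2F ∷ 1F ∷ 0F ∷ [])
certificate₅ (2F ∷ 0F ∷ 3F ∷ 1F ∷ 4F ∷ []) = (0F ∷ 1F ∷ 2F ∷ 3F ∷ 4F ∷ []) , (3F ∷ 1F ∷ 4F ∷ 2F ∷ 0F ∷ []) , (2F ∷ 3F ∷ 4F ∷ 0F ∷ 1F ∷ [])
certificate₅ (2F ∷ 0F ∷ 3F ∷ 4F ∷ 1F ∷ []) = (0F ∷ 1F ∷ 0F ∷ 2F ∷ 1F ∷ []) , (1F ∷ 0F ∷ 2F ∷ 1F ∷ 0F ∷ []) , (2F ∷ 2F ∷ 2F ∷ 1F ∷ 0F ∷ [])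
certificate₅ (2F ∷ 0F ∷ 4F ∷ 1F ∷ 3F ∷ []) = (0F ∷ 1F ∷ 0F ∷ 1F ∷ 2F ∷ []) , (0F ∷ 2F ∷ 1F ∷ 0F ∷ 1F ∷ []) , (1F ∷ 2F ∷ 2F ∷ 2F ∷ 0F ∷ [])
certificate₅ (2F ∷ 0F ∷ 4F ∷ 3F ∷ 1F ∷ []) = (0F ∷ 1F ∷ 0F ∷ 1F ∷ 2F ∷ []) , (0F ∷ 2F ∷ 1F ∷ 0F ∷ 1F ∷ []) , (1F ∷ 2F ∷ 2F ∷ 2F ∷ 0F ∷ [])
certificate₅ (2F ∷ 1F ∷ 0F ∷ 3F ∷ 4F ∷ []) = (0F ∷ 1F ∷ 0F ∷ 2F ∷ 1F ∷ []) , (0F ∷ 1F ∷ 0F ∷ 2F ∷ 1F ∷ []) , (2F ∷ 2F ∷ 2F ∷ 1F ∷ 0F ∷ [])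
certificate₅ (2F ∷ 1F ∷ 0F ∷ 4F ∷ 3F ∷ []) = (0F ∷ 1F ∷ 0F ∷ 1F ∷ 2F ∷ []) , (1F ∷ 0F ∷ 2F ∷ 1F ∷ 0F ∷ []) , (1F ∷ 2F ∷ 2F ∷ 2F ∷ 0F ∷ [])
certificate₅ (2F ∷ 1F ∷ 3F ∷ 0F ∷ 4F ∷ []) = (0F ∷ 1F ∷ 0F ∷ 1F ∷ 2F ∷ []) , (0F ∷ 1F ∷ 0F ∷ 2F ∷ 1F ∷ []) , (1F ∷ 2F ∷ 2F ∷ 2F ∷ 0F ∷ [])
certificate₅ (2F ∷ 1F ∷ 3F ∷ 4F ∷ 0F ∷ []) = (0F ∷ 1F ∷ 0F ∷ 1F ∷ 2F ∷ []) , (1F ∷ 0F ∷ 1F ∷ 2F ∷ 0F ∷ []) , (1F ∷ 2F ∷ 2F ∷ 2F ∷ 0F ∷ [])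
certificate₅ (2F ∷ 1F ∷ 4F ∷ 0F ∷ 3F ∷ []) = (0F ∷ 1F ∷ 0F ∷ 1F ∷ 2F ∷ []) , (0F ∷ 1F ∷ 2F ∷ 0F ∷ 1F ∷ []) , (1F ∷ 2F ∷ 2F ∷ 2F ∷ 0F ∷ [])
certificate₅ (2F ∷ 1F ∷ 4F ∷ 3F ∷ 0F ∷ []) = (0F ∷ 1F ∷ 0F ∷ 2F ∷ 1F ∷ []) , (0F ∷ 1F ∷ 2F ∷ 0F ∷ 1F ∷ []) , (2F ∷ 2F ∷ 2F ∷ 1F ∷ 0F ∷ [])
certificate₅ (2F ∷ 3F ∷ 0F ∷ 1F ∷ 4F ∷ []) = (0F ∷ 1F ∷ 2F ∷ 0F ∷ 1F ∷ []) , (2F ∷ 0F ∷ 1F ∷ 0F ∷ 1F ∷ []) , (2F ∷ 2F ∷ 0F ∷ 1F ∷ 2F ∷ [])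
certificate₅ (2F ∷ 3F ∷ 0F ∷ 4F ∷ 1F ∷ []) = (0F ∷ 1F ∷ 0F ∷ 1F ∷ 2F ∷ []) , (1F ∷ 0F ∷ 2F ∷ 1F ∷ 0F ∷ []) , (1F ∷ 2F ∷ 2F ∷ 2F ∷ 0F ∷ [])
certificate₅ (2F ∷ 3F ∷ 1F ∷ 0F ∷ 4F ∷ []) = (0F ∷ 1F ∷ 0F ∷ 1F ∷ 2F ∷ []) , (0F ∷ 1F ∷ 0F ∷ 2F ∷ 1F ∷ []) , (1F ∷ 2F ∷ 2F ∷ 2F ∷ 0F ∷ [])
certificate₅ (2F ∷ 3F ∷ 1F ∷ 4F ∷ 0F ∷ []) = (0F ∷ 1F ∷ 0F ∷ 1F ∷ 2F ∷ []) , (1F ∷ 0F ∷ 1F ∷ 2F ∷ 0F ∷ []) , (1F ∷ 2F ∷ 2F ∷ 2F ∷ 0F ∷ [])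
certificate₅ (2F ∷ 3F ∷ 4F ∷ 0F ∷ 1F ∷ []) = (0F ∷ 1F ∷ 0F ∷ 1F ∷ 2F ∷ []) , (0F ∷ 1F ∷ 2F ∷ 0F ∷ 1F ∷ []) , (1F ∷ 2F ∷ 2F ∷ 2F ∷ 0F ∷ [])
certificate₅ (2F ∷ 3F ∷ 4F ∷ 1F ∷ 0F ∷ []) = (0F ∷ 1F ∷ 0F ∷ 2F ∷ 1F ∷ []) , (0F ∷ 2F ∷ 1F ∷ 0F ∷ 1F ∷ []) , (2F ∷ 2F ∷ 2F ∷ 1F ∷ 0F ∷ [])
certificate₅ (2F ∷ 4F ∷ 0F ∷ 1F ∷ 3F ∷ []) = (0F ∷ 1F ∷ 0F ∷ 1F ∷ 2F ∷ []) , (1F ∷ 2F ∷ 0F ∷ 1F ∷ 0F ∷ []) , (1F ∷ 2F ∷ 2F ∷ 2F ∷ 0F ∷ [])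
certificate₅ (2F ∷ 4F ∷ 0F ∷ 3F ∷ 1F ∷ []) = (0F ∷ 1F ∷ 0F ∷ 1F ∷ 2F ∷ []) , (1F ∷ 2F ∷ 0F ∷ 1F ∷ 0F ∷ []) , (1F ∷ 2F ∷ 2F ∷ 2F ∷ 0F ∷ [])
certificate₅ (2F ∷ 4F ∷ 1F ∷ 0F ∷ 3F ∷ []) = (0F ∷ 1F ∷ 2F ∷ 0F ∷ 1F ∷ []) , (1F ∷ 0F ∷ 1F ∷ 0F ∷ 2F ∷ []) , (2F ∷ 2F ∷ 0F ∷ 1F ∷ 2F ∷ [])
certificate₅ (2F ∷ 4F ∷ 1F ∷ 3F ∷ 0F ∷ []) = (0F ∷ 1F ∷ 2F ∷ 3F ∷ 4F ∷ []) , (0F ∷ 2F ∷ 4F ∷ 1F ∷ 3F ∷ []) , (2F ∷ 3F ∷ 4F ∷ 0F ∷ 1F ∷ [])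
certificate₅ (2F ∷ 4F ∷ 3F ∷ 0F ∷ 1F ∷ []) = (0F ∷ 1F ∷ 0F ∷ 2F ∷ 1F ∷ []) , (1F ∷ 2F ∷ 0F ∷ 1F ∷ 0F ∷ []) , (2F ∷ 2F ∷ 2F ∷ 1F ∷ 0F ∷ [])
certificate₅ (2F ∷ 4F ∷ 3F ∷ 1F ∷ 0F ∷ []) = (0F ∷ 1F ∷ 0F ∷ 2F ∷ 1F ∷ []) , (1F ∷ 2F ∷ 0F ∷ 1F ∷ 0F ∷ []) , (2F ∷ 2F ∷ 2F ∷ 1F ∷ 0F ∷ [])
certificate₅ (3F ∷ 0F ∷ 1F ∷ 2F ∷ 4F ∷ []) = (0F ∷ 1F ∷ 0F ∷ 2F ∷ 1F ∷ []) , (0F ∷ 1F ∷ 0F ∷ 1F ∷ 2F ∷ []) , (2F ∷ 2F ∷ 2F ∷ 1F ∷ 0F ∷ [])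
certificate₅ (3F ∷ 0F ∷ 1F ∷ 4F ∷ 2F ∷ []) = (0F ∷ 1F ∷ 2F ∷ 0F ∷ 1F ∷ []) , (0F ∷ 1F ∷ 0F ∷ 1F ∷ 2F ∷ []) , (2F ∷ 2F ∷ 0F ∷ 1F ∷ 2F ∷ [])
certificate₅ (3F ∷ 0F ∷ 2F ∷ 1F ∷ 4F ∷ []) = (0F ∷ 1F ∷ 0F ∷ 2F ∷ 1F ∷ []) , (0F ∷ 1F ∷ 0F ∷ 1F ∷ 2F ∷ []) , (2F ∷ 2F ∷ 2F ∷ 1F ∷ 0F ∷ [])
certificate₅ (3F ∷ 0F ∷ 2F ∷ 4F ∷ 1F ∷ []) = (0F ∷ 1F ∷ 2F ∷ 3F ∷ 4F ∷ []) , (1F ∷ 3F ∷ 0F ∷ 2F ∷ 4F ∷ []) , (2F ∷ 3F ∷ 4F ∷ 0F ∷ 1F ∷ [])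
certificate₅ (3F ∷ 0F ∷ 4F ∷ 1F ∷ 2F ∷ []) = (0F ∷ 1F ∷ 0F ∷ 1F ∷ 2F ∷ []) , (0F ∷ 2F ∷ 1F ∷ 0F ∷ 1F ∷ []) , (1F ∷ 2F ∷ 2F ∷ 2F ∷ 0F ∷ [])
certificate₅ (3F ∷ 0F ∷ 4F ∷ 2F ∷ 1F ∷ []) = (0F ∷ 1F ∷ 0F ∷ 1F ∷ 2F ∷ []) , (0F ∷ 2F ∷ 1F ∷ 0F ∷ 1F ∷ []) , (1F ∷ 2F ∷ 2F ∷ 2F ∷ 0F ∷ [])
certificate₅ (3F ∷ 1F ∷ 0F ∷ 2F ∷ 4F ∷ []) = (0F ∷ 1F ∷ 0F ∷ 2F ∷ 1F ∷ []) , (0F ∷ 1F ∷ 0F ∷ 1F ∷ 2F ∷ []) , (2F ∷ 2F ∷ 2F ∷ 1F ∷ 0F ∷ [])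
certificate₅ (3F ∷ 1F ∷ 0F ∷ 4F ∷ 2F ∷ []) = (0F ∷ 1F ∷ 0F ∷ 1F ∷ 2F ∷ []) , (1F ∷ 0F ∷ 2F ∷ 1F ∷ 0F ∷ []) , (1F ∷ 2F ∷ 2F ∷ 2F ∷ 0F ∷ [])
certificate₅ (3F ∷ 1F ∷ 2F ∷ 0F ∷ 4F ∷ []) = (0F ∷ 1F ∷ 0F ∷ 1F ∷ 2F ∷ []) , (0F ∷ 1F ∷ 0F ∷ 2F ∷ 1F ∷ []) , (1F ∷ 2F ∷ 2F ∷ 2F ∷ 0F ∷ [])
certificate₅ (3F ∷ 1F ∷ 2F ∷ 4F ∷ 0F ∷ []) = (0F ∷ 1F ∷ 0F ∷ 1F ∷ 2F ∷ []) , (1F ∷ 0F ∷ 1F ∷ 2F ∷ 0F ∷ []) , (1F ∷ 2F ∷ 2F ∷ 2F ∷ 0F ∷ [])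
certificate₅ (3F ∷ 1F ∷ 4F ∷ 0F ∷ 2F ∷ []) = (0F ∷ 1F ∷ 0F ∷ 1F ∷ 2F ∷ []) , (0F ∷ 1F ∷ 2F ∷ 0F ∷ 1F ∷ []) , (1F ∷ 2F ∷ 2F ∷ 2F ∷ 0F ∷ [])
certificate₅ (3F ∷ 1F ∷ 4F ∷ 2F ∷ 0F ∷ []) = (0F ∷ 1F ∷ 2F ∷ 3F ∷ 4F ∷ []) , (4F ∷ 2F ∷ 0F ∷ 3F ∷ 1F ∷ []) , (2F ∷ 3F ∷ 4F ∷ 0F ∷ 1F ∷ [])
certificate₅ (3F ∷ 2F ∷ 0F ∷ 1F ∷ 4F ∷ []) = (0F ∷ 1F ∷ 0F ∷ 2F ∷ 1F ∷ []) , (0F ∷ 1F ∷ 0F ∷ 1F ∷ 2F ∷ []) , (2F ∷ 2F ∷ 2F ∷ 1F ∷ 0F ∷ [])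
certificate₅ (3F ∷ 2F ∷ 0F ∷ 4F ∷ 1F ∷ []) = (0F ∷ 1F ∷ 0F ∷ 1F ∷ 2F ∷ []) , (1F ∷ 0F ∷ 2F ∷ 1F ∷ 0F ∷ []) , (1F ∷ 2F ∷ 2F ∷ 2F ∷ 0F ∷ [])
certificate₅ (3F ∷ 2F ∷ 1F ∷ 0F ∷ 4F ∷ []) = (0F ∷ 1F ∷ 0F ∷ 1F ∷ 2F ∷ []) , (0F ∷ 1F ∷ 0F ∷ 2F ∷ 1F ∷ []) , (1F ∷ 2F ∷ 2F ∷ 2F ∷ 0F ∷ [])
certificate₅ (3F ∷ 2F ∷ 1F ∷ 4F ∷ 0F ∷ []) = (0F ∷ 1F ∷ 0F ∷ 1F ∷ 2F ∷ []) , (1F ∷ 0F ∷ 1F ∷ 2F ∷ 0F ∷ []) , (1F ∷ 2F ∷ 2F ∷ 2F ∷ 0F ∷ [])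
certificate₅ (3F ∷ 2F ∷ 4F ∷ 0F ∷ 1F ∷ []) = (0F ∷ 1F ∷ 0F ∷ 1F ∷ 2F ∷ []) , (0F ∷ 1F ∷ 2F ∷ 0F ∷ 1F ∷ []) , (1F ∷ 2F ∷ 2F ∷ 2F ∷ 0F ∷ [])
certificate₅ (3F ∷ 2F ∷ 4F ∷ 1F ∷ 0F ∷ []) = (0F ∷ 1F ∷ 2F ∷ 0F ∷ 1F ∷ []) , (2F ∷ 1F ∷ 0F ∷ 1F ∷ 0F ∷ []) , (2F ∷ 2F ∷ 0F ∷ 1F ∷ 2F ∷ [])
certificate₅ (3F ∷ 4F ∷ 0F ∷ 1F ∷ 2F ∷ []) = (0F ∷ 1F ∷ 0F ∷ 1F ∷ 2F ∷ []) , (1F ∷ 2F ∷ 0F ∷ 1F ∷ 0F ∷ []) , (1F ∷ 2F ∷ 2F ∷ 2F ∷ 0F ∷ [])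
certificate₅ (3F ∷ 4F ∷ 0F ∷ 2F ∷ 1F ∷ []) = (0F ∷ 1F ∷ 0F ∷ 1F ∷ 2F ∷ []) , (1F ∷ 2F ∷ 0F ∷ 1F ∷ 0F ∷ []) , (1F ∷ 2F ∷ 2F ∷ 2F ∷ 0F ∷ [])
certificate₅ (3F ∷ 4F ∷ 1F ∷ 0F ∷ 2F ∷ []) = (0F ∷ 1F ∷ 0F ∷ 2F ∷ 1F ∷ []) , (2F ∷ 1F ∷ 0F ∷ 1F ∷ 0F ∷ []) , (2F ∷ 2F ∷ 2F ∷ 1F ∷ 0F ∷ [])
certificate₅ (3F ∷ 4F ∷ 1F ∷ 2F ∷ 0F ∷ []) = (0F ∷ 1F ∷ 0F ∷ 2F ∷ 1F ∷ []) , (2F ∷ 1F ∷ 0F ∷ 1F ∷ 0F ∷ []) , (2F ∷ 2F ∷ 2F ∷ 1F ∷ 0F ∷ [])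
certificate₅ (3F ∷ 4F ∷ 2F ∷ 0F ∷ 1F ∷ []) = (0F ∷ 1F ∷ 0F ∷ 2F ∷ 1F ∷ []) , (2F ∷ 1F ∷ 0F ∷ 1F ∷ 0F ∷ []) , (2F ∷ 2F ∷ 2F ∷ 1F ∷ 0F ∷ [])
certificate₅ (3F ∷ 4F ∷ 2F ∷ 1F ∷ 0F ∷ []) = (0F ∷ 1F ∷ 0F ∷ 2F ∷ 1F ∷ []) , (2F ∷ 1F ∷ 0F ∷ 1F ∷ 0F ∷ []) , (2F ∷ 2F ∷ 2F ∷ 1F ∷ 0F ∷ [])
certificate₅ (4F ∷ 0F ∷ 1F ∷ 2F ∷ 3F ∷ []) = (0F ∷ 1F ∷ 0F ∷ 1F ∷ 2F ∷ []) , (2F ∷ 0F ∷ 1F ∷ 0F ∷ 1F ∷ []) , (1F ∷ 2F ∷ 2F ∷ 2F ∷ 0F ∷ [])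
certificate₅ (4F ∷ 0F ∷ 1F ∷ 3F ∷ 2F ∷ []) = (0F ∷ 1F ∷ 0F ∷ 1F ∷ 2F ∷ []) , (2F ∷ 0F ∷ 1F ∷ 0F ∷ 1F ∷ []) , (1F ∷ 2F ∷ 2F ∷ 2F ∷ 0F ∷ [])
certificate₅ (4F ∷ 0F ∷ 2F ∷ 1F ∷ 3F ∷ []) = (0F ∷ 1F ∷ 0F ∷ 1F ∷ 2F ∷ []) , (2F ∷ 0F ∷ 1F ∷ 0F ∷ 1F ∷ []) , (1F ∷ 2F ∷ 2F ∷ 2F ∷ 0F ∷ [])
certificate₅ (4F ∷ 0F ∷ 2F ∷ 3F ∷ 1F ∷ []) = (0F ∷ 1F ∷ 0F ∷ 1F ∷ 2F ∷ []) , (2F ∷ 0F ∷ 1F ∷ 0F ∷ 1F ∷ []) , (1F ∷ 2F ∷ 2F ∷ 2F ∷ 0F ∷ [])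
certificate₅ (4F ∷ 0F ∷ 3F ∷ 1F ∷ 2F ∷ []) = (0F ∷ 1F ∷ 0F ∷ 1F ∷ 2F ∷ []) , (2F ∷ 0F ∷ 1F ∷ 0F ∷ 1F ∷ []) , (1F ∷ 2F ∷ 2F ∷ 2F ∷ 0F ∷ [])
certificate₅ (4F ∷ 0F ∷ 3F ∷ 2F ∷ 1F ∷ []) = (0F ∷ 1F ∷ 0F ∷ 1F ∷ 2F ∷ []) , (2F ∷ 0F ∷ 1F ∷ 0F ∷ 1F ∷ []) , (1F ∷ 2F ∷ 2F ∷ 2F ∷ 0F ∷ [])
certificate₅ (4F ∷ 1F ∷ 0F ∷ 2F ∷ 3F ∷ []) = (0F ∷ 1F ∷ 0F ∷ 2F ∷ 1F ∷ []) , (1F ∷ 0F ∷ 1F ∷ 0F ∷ 2F ∷ []) , (2F ∷ 2F ∷ 2F ∷ 1F ∷ 0F ∷ [])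
certificate₅ (4F ∷ 1F ∷ 0F ∷ 3F ∷ 2F ∷ []) = (0F ∷ 1F ∷ 2F ∷ 0F ∷ 1F ∷ []) , (0F ∷ 1F ∷ 0F ∷ 2F ∷ 1F ∷ []) , (2F ∷ 2F ∷ 0F ∷ 1F ∷ 2F ∷ [])
certificate₅ (4F ∷ 1F ∷ 2F ∷ 0F ∷ 3F ∷ []) = (0F ∷ 1F ∷ 0F ∷ 2F ∷ 1F ∷ []) , (1F ∷ 0F ∷ 1F ∷ 0F ∷ 2F ∷ []) , (2F ∷ 2F ∷ 2F ∷ 1F ∷ 0F ∷ [])
certificate₅ (4F ∷ 1F ∷ 2F ∷ 3F ∷ 0F ∷ []) = (0F ∷ 1F ∷ 0F ∷ 1F ∷ 2F ∷ []) , (1F ∷ 0F ∷ 1F ∷ 0F ∷ 2F ∷ []) , (1F ∷ 2F ∷ 2F ∷ 2F ∷ 0F ∷ [])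
certificate₅ (4F ∷ 1F ∷ 3F ∷ 0F ∷ 2F ∷ []) = (0F ∷ 1F ∷ 2F ∷ 3F ∷ 4F ∷ []) , (2F ∷ 4F ∷ 1F ∷ 3F ∷ 0F ∷ []) , (2F ∷ 3F ∷ 4F ∷ 0F ∷ 1F ∷ [])
certificate₅ (4F ∷ 1F ∷ 3F ∷ 2F ∷ 0F ∷ []) = (0F ∷ 1F ∷ 0F ∷ 1F ∷ 2F ∷ []) , (1F ∷ 0F ∷ 1F ∷ 0F ∷ 2F ∷ []) , (1F ∷ 2F ∷ 2F ∷ 2F ∷ 0F ∷ [])
certificate₅ (4F ∷ 2F ∷ 0F ∷ 1F ∷ 3F ∷ []) = (0F ∷ 1F ∷ 0F ∷ 2F ∷ 1F ∷ []) , (1F ∷ 0F ∷ 1F ∷ 0F ∷ 2F ∷ []) , (2F ∷ 2F ∷ 2F ∷ 1F ∷ 0F ∷ [])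
certificate₅ (4F ∷ 2F ∷ 0F ∷ 3F ∷ 1F ∷ []) = (0F ∷ 1F ∷ 2F ∷ 3F ∷ 4F ∷ []) , (0F ∷ 3F ∷ 1F ∷ 4F ∷ 2F ∷ []) , (2F ∷ 3F ∷ 4F ∷ 0F ∷ 1F ∷ [])
certificate₅ (4F ∷ 2F ∷ 1F ∷ 0F ∷ 3F ∷ []) = (0F ∷ 1F ∷ 0F ∷ 2F ∷ 1F ∷ []) , (1F ∷ 0F ∷ 1F ∷ 0F ∷ 2F ∷ []) , (2F ∷ 2F ∷ 2F ∷ 1F ∷ 0F ∷ [])
certificate₅ (4F ∷ 2F ∷ 1F ∷ 3F ∷ 0F ∷ []) = (0F ∷ 1F ∷ 0F ∷ 1F ∷ 2F ∷ []) , (1F ∷ 0F ∷ 1F ∷ 0F ∷ 2F ∷ []) , (1F ∷ 2F ∷ 2F ∷ 2F ∷ 0F ∷ [])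
certificate₅ (4F ∷ 2F ∷ 3F ∷ 0F ∷ 1F ∷ []) = (0F ∷ 1F ∷ 2F ∷ 0F ∷ 1F ∷ []) , (1F ∷ 2F ∷ 0F ∷ 1F ∷ 0F ∷ []) , (2F ∷ 2F ∷ 0F ∷ 1F ∷ 2F ∷ [])
certificate₅ (4F ∷ 2F ∷ 3F ∷ 1F ∷ 0F ∷ []) = (0F ∷ 1F ∷ 0F ∷ 1F ∷ 2F ∷ []) , (1F ∷ 0F ∷ 1F ∷ 0F ∷ 2F ∷ []) , (1F ∷ 2F ∷ 2F ∷ 2F ∷ 0F ∷ [])
certificate₅ (4F ∷ 3F ∷ 0F ∷ 1F ∷ 2F ∷ []) = (0F ∷ 1F ∷ 0F ∷ 2F ∷ 1F ∷ []) , (2F ∷ 0F ∷ 1F ∷ 0F ∷ 1F ∷ []) , (2F ∷ 2F ∷ 2F ∷ 1F ∷ 0F ∷ [])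
certificate₅ (4F ∷ 3F ∷ 0F ∷ 2F ∷ 1F ∷ []) = (0F ∷ 1F ∷ 0F ∷ 2F ∷ 1F ∷ []) , (2F ∷ 0F ∷ 1F ∷ 0F ∷ 1F ∷ []) , (2F ∷ 2F ∷ 2F ∷ 1F ∷ 0F ∷ [])
certificate₅ (4F ∷ 3F ∷ 1F ∷ 0F ∷ 2F ∷ []) = (0F ∷ 1F ∷ 0F ∷ 2F ∷ 1F ∷ []) , (2F ∷ 0F ∷ 1F ∷ 0F ∷ 1F ∷ []) , (2F ∷ 2F ∷ 2F ∷ 1F ∷ 0F ∷ [])
certificate₅ (4F ∷ 3F ∷ 1F ∷ 2F ∷ 0F ∷ []) = (0F ∷ 1F ∷ 0F ∷ 1F ∷ 2F ∷ []) , (1F ∷ 0F ∷ 1F ∷ 0F ∷ 2F ∷ []) , (1F ∷ 2F ∷ 2F ∷ 2F ∷ 0F ∷ [])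
certificate₅ (4F ∷ 3F ∷ 2F ∷ 0F ∷ 1F ∷ []) = (0F ∷ 1F ∷ 0F ∷ 2F ∷ 1F ∷ []) , (2F ∷ 0F ∷ 1F ∷ 0F ∷ 1F ∷ []) , (2F ∷ 2F ∷ 2F ∷ 1F ∷ 0F ∷ [])
certificate₅ (4F ∷ 3F ∷ 2F ∷ 1F ∷ 0F ∷ []) = (0F ∷ 1F ∷ 0F ∷ 1F ∷ 2F ∷ []) , (1F ∷ 0F ∷ 1F ∷ 0F ∷ 2F ∷ []) , (1F ∷ 2F ∷ 2F ∷ 2F ∷ 0F ∷ [])
certificate₅ _ = replicate 5 0F , replicate 5 0F , replicate 5 0F

theorem5 : (n : ℕ) → 3 ≤ n → (p : Permutation′ n) →
    Σ (Coloring n 6) (λ c → NormalColoring p c)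
theorem5 1 (s≤s ())
theorem5 2 (s≤s (s≤s ()))
theorem5 3 _ = certifiedColouring certificate₃ _
theorem5 4 _ p = fromKleinLabelling (evenLabelling refl p)
theorem5 5 _ = certifiedColouring certificate₅ _
theorem5 6 _ p = fromKleinLabelling (evenLabelling refl p)
theorem5 (suc (suc (suc (suc (suc (suc (suc k))))))) _ p with odd (6 + k) in parity
... | true  = fromKleinLabelling (evenLabelling parity p)
... | false = fromKleinLabelling (oddLabelling-exists k parity p)
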